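{- Let $G$ be a graph with at least four vertices and let $k \ge 3$. Suppose $G$ is the niche graph of a $k$-partite tournament $D$, and suppose $u$ and $v$ are two distinct vertices of $D$ that are true twins in $D$. Then $D-v$ is a $k$-partite tournament whose niche graph is $G-v$.
   Context: A $k$-partite tournament is an orientation of a complete $k$-partite graph with $k$ nonempty partite sets. The niche graph $\mathcal{N}(D)$ of a digraph $D$ has vertex set $V(D)$, and two distinct vertices are adjacent iff they have a common out-neighbor in $D$ or a common in-neighbor in $D$. Two vertices $u,v$ of a digraph $D$ are true twins in $D$ if $N^+_D(u)=N^+_D(v)$ and $N^-_D(u)=N^-_D(v)$ (same open out-neighborhood and same open in-neighborhood). -}

module Defs where

open import Data.Nat using (ℕ; suc)
open import Data.Fin using (Fin; punchIn)
open import Data.Product using (Σ; ∃; _×_)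
open import Data.Sum using (_⊎_)
open import Relation.Nullary using (¬_)
open import Relation.Binary.PropositionalEquality using (_≡_; _≢_)
open import Function.Bundles using (_⇔_)
open import Function.Definitions using (Surjective)

Digraph : ℕ → Set₁
Digraph n = Fin n → Fin n → Set

Graph : ℕ → Set₁
Graph n = Fin n → Fin n → Set

-- D is an orientation of the complete k-partite graph whose partite sets are
-- the fibres of part : Fin n → Fin k; all k parts are nonempty (surjectivity).
IsKPartiteTournamentWith : ∀ {n} (k : ℕ) → Digraph n → (Fin n → Fin k) → Set
IsKPartiteTournamentWith {n} k D part =
  Surjective _≡_ _≡_ part
  × (∀ x y → part x ≡ part y → ¬ D x y)
  × (∀ x y → part x ≢ part y → (D x y × ¬ D y x) ⊎ (D y x × ¬ D x y))

IsKPartiteTournament : ∀ {n} (k : ℕ) → Digraph n → Set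
IsKPartiteTournament {n} k D = Σ (Fin n → Fin k) (IsKPartiteTournamentWith k D)

Niche : ∀ {n} → Digraph n → Graph n
Niche D x y = x ≢ y × ((∃ λ z → D x z × D y z) ⊎ (∃ λ z → D z x × D z y))

IsNicheGraphOf : ∀ {n} → Graph n → Digraph n → Set
IsNicheGraphOf G D = ∀ x y → G x y ⇔ Niche D x y

TrueTwins : ∀ {n} → Digraph n → Fin n → Fin n → Set
TrueTwins D u v = ∀ w → (D u w ⇔ D v w) × (D w u ⇔ D w v)

deleteD : ∀ {m} → Digraph (suc m) → Fin (suc m) → Digraph m
deleteD D v x y = D (punchIn v x) (punchIn v y)

deleteG : ∀ {m} → Graph (suc m) → Fin (suc m) → Graph m
deleteG G v x y = G (punchIn v x) (punchIn v y)

module Submission where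

open import Defs
open import Data.Nat using (ℕ; suc; _≤_)
open import Data.Fin using (Fin; punchIn; punchOut)
open import Data.Fin.Properties using (_≟_; punchIn-injective; punchIn-punchOut)
open import Data.Product using (_×_; _,_; proj₁; proj₂; ∃; map₂)
open import Data.Sum using (inj₁; inj₂)
open import Data.Empty using (⊥-elim)
open import Relation.Nullary using (yes; no)
open import Relation.Binary.PropositionalEquality using (_≡_; _≢_; refl; sym; trans; cong; subst)
open import Function using (_∘_)
open import Function.Bundles using (_⇔_; mk⇔; Equivalence)
open import Function.Construct.Composition using (_⇔-∘_)
open import Function.Construct.Symmetry using (⇔-sym)

open Equivalence using (to; from)

-- A witness at the deleted vertex v is replaced by its stand-in u; any other
-- witness already lies in the image of punchIn v.
∃-punchIn : ∀ {m} {P : Fin (suc m) → Set} {u v : Fin (suc m)} →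
            u ≢ v → (P v → P u) → ∃ P → ∃ λ x → P (punchIn v x)
∃-punchIn {P = P} {v = v} u≢v Pv⇒Pu (x , Px) with v ≟ x
... | yes refl = punchOut (u≢v ∘ sym) , subst P (sym (punchIn-punchOut _)) (Pv⇒Pu Px)
... | no v≢x   = punchOut v≢x , subst P (sym (punchIn-punchOut v≢x)) Px

-- Twins in different parts would be joined by an arc, which the twin property turns into a loop.
twins⇒samePart : ∀ {n k} {D : Digraph n} {part : Fin n → Fin k} {u v : Fin n} →
                 IsKPartiteTournamentWith k D part → TrueTwins D u v → part u ≡ part v
twins⇒samePart {part = part} {u} {v} (_ , independent , oriented) twins with part u ≟ part v
... | yes same = same
... | no differ with oriented u v differ
...   | inj₁ (uv , _) = ⊥-elim (independent v v refl (to (proj₁ (twins v)) uv))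
...   | inj₂ (vu , _) = ⊥-elim (independent v v refl (to (proj₂ (twins v)) vu))

deleteD-isKPartiteTournamentWith :
  ∀ {m k} {D : Digraph (suc m)} {part : Fin (suc m) → Fin k} {u v : Fin (suc m)} →
  u ≢ v → part u ≡ part v → IsKPartiteTournamentWith k D part →
  IsKPartiteTournamentWith k (deleteD D v) (part ∘ punchIn v)
deleteD-isKPartiteTournamentWith {part = part} u≢v samePart (surjective , independent , oriented) =
  surjective′ , (λ x y → independent (punchIn _ x) (punchIn _ y))
              , (λ x y → oriented (punchIn _ x) (punchIn _ y))
  where
  surjective′ : ∀ p → ∃ λ x → ∀ {z} → z ≡ x → part (punchIn _ z) ≡ p
  surjective′ p with ∃-punchIn {P = λ x → part x ≡ p} u≢v (trans samePart)
                               (map₂ (λ e → e refl) (surjective p))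
  ... | x , e = x , λ { refl → e }

niche-deleteD : ∀ {m} {D : Digraph (suc m)} {u v : Fin (suc m)} → u ≢ v → TrueTwins D u v →
                ∀ x y → Niche (deleteD D v) x y ⇔ Niche D (punchIn v x) (punchIn v y)
niche-deleteD {D = D} {v = v} u≢v twins x y = mk⇔ extend restrict
  where
  extend : Niche (deleteD D v) x y → Niche D (punchIn v x) (punchIn v y)
  extend (x≢y , inj₁ (z , common)) = x≢y ∘ punchIn-injective v x y , inj₁ (punchIn v z , common)
  extend (x≢y , inj₂ (z , common)) = x≢y ∘ punchIn-injective v x y , inj₂ (punchIn v z , common)

  restrict : Niche D (punchIn v x) (punchIn v y) → Niche (deleteD D v) x y
  restrict (x≢y , inj₁ common) = x≢y ∘ cong (punchIn v) , inj₁ (∃-punchIn u≢v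
    (λ (ax , ay) → from (proj₂ (twins _)) ax , from (proj₂ (twins _)) ay) common)
  restrict (x≢y , inj₂ common) = x≢y ∘ cong (punchIn v) , inj₂ (∃-punchIn u≢v
    (λ (xa , ya) → from (proj₁ (twins _)) xa , from (proj₁ (twins _)) ya) common)

proposition3p4 : (m k : ℕ) → 4 ≤ suc m → 3 ≤ k →
    (G : Graph (suc m)) (D : Digraph (suc m)) →
    IsKPartiteTournament k D → IsNicheGraphOf G D →
    (u v : Fin (suc m)) → u ≢ v → TrueTwins D u v →
    IsKPartiteTournament k (deleteD D v) × IsNicheGraphOf (deleteG G v) (deleteD D v)
proposition3p4 m k _ _ G D (part , tournament) niche u v u≢v twins =
    (part ∘ punchIn v ,
     deleteD-isKPartiteTournamentWith u≢v (twins⇒samePart tournament twins) tournament)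
  , λ x y → ⇔-sym (niche-deleteD u≢v twins x y) ⇔-∘ niche (punchIn v x) (punchIn v y)
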